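{- If $T$ is a tree with $n \ge 2$ vertices, then $\gamma_{\times 2}(T) + \gamma(T) \ge n + 1$.
   Context: $N[v]$ is the closed neighbourhood of a vertex $v$. A set $S \subseteq V(T)$ is dominating if every vertex is in $S$ or adjacent to a vertex of $S$; $\gamma(T)$ is the minimum cardinality of a dominating set. A set $S$ is a double dominating set if $|N[v] \cap S| \ge 2$ for every vertex $v$; $\gamma_{\times 2}(T)$ is the minimum cardinality of a double dominating set (which exists for every tree with at least two vertices). -}

module Defs where

open import Data.Nat using (ℕ; suc; _≤_; _+_)
open import Data.Fin using (Fin)
open import Data.Fin.Subset using (Subset; _∈_; ∣_∣)
open import Data.List using (List; []; _∷_; length)
open import Data.List.Relation.Unary.AllPairs using (AllPairs)
open import Data.List.Relation.Unary.Unique.Propositional using (Unique)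
open import Data.Product using (Σ; _×_; ∃)
open import Data.Sum using (_⊎_)
open import Relation.Binary.PropositionalEquality using (_≡_; _≢_)
open import Relation.Nullary using (¬_)

record Graph (n : ℕ) : Set₁ where
  field
    Adj   : Fin n → Fin n → Set
    sym   : ∀ {u v} → Adj u v → Adj v u
    irrefl : ∀ {u} → ¬ Adj u u

open Graph public

data Walk {n : ℕ} (G : Graph n) : Fin n → Fin n → List (Fin n) → Set where
  here : ∀ {u} → Walk G u u (u ∷ [])
  step : ∀ {u w v vs} → Adj G u w → Walk G w v vs → Walk G u v (u ∷ vs)

Connected : ∀ {n} → Graph n → Set
Connected {n} G = ∀ (u v : Fin n) → ∃ λ vs → Walk G u v vs

-- A cycle: a path u = v₀, …, v_k = w with distinct vertices, k ≥ 2, plus the edge w u.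
HasCycle : ∀ {n} → Graph n → Set
HasCycle {n} G =
  Σ (Fin n) λ u → Σ (Fin n) λ w → Σ (List (Fin n)) λ vs →
    Walk G u w vs × Unique vs × 3 ≤ length vs × Adj G w u

Acyclic : ∀ {n} → Graph n → Set
Acyclic G = ¬ HasCycle G

IsTree : ∀ {n} → Graph n → Set
IsTree G = Connected G × Acyclic G

Dominating : ∀ {n} → Graph n → Subset n → Set
Dominating {n} G S = ∀ (v : Fin n) → v ∈ S ⊎ (Σ (Fin n) λ u → u ∈ S × Adj G v u)

-- S is double dominating: |N[v] ∩ S| ≥ 2 for every v, i.e. N[v] contains two
-- distinct vertices of S.
InClosedNbhd : ∀ {n} → Graph n → Fin n → Fin n → Set
InClosedNbhd G v u = u ≡ v ⊎ Adj G v u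

DoubleDominating : ∀ {n} → Graph n → Subset n → Set
DoubleDominating {n} G S = ∀ (v : Fin n) →
  Σ (Fin n) λ a → Σ (Fin n) λ b → a ≢ b ×
    (a ∈ S × InClosedNbhd G v a) × (b ∈ S × InClosedNbhd G v b)

IsDominationNumber : ∀ {n} → Graph n → ℕ → Set
IsDominationNumber {n} G k =
  (Σ (Subset n) λ S → Dominating G S × ∣ S ∣ ≡ k) ×
  (∀ (S : Subset n) → Dominating G S → k ≤ ∣ S ∣)

IsDoubleDominationNumber : ∀ {n} → Graph n → ℕ → Set
IsDoubleDominationNumber {n} G k =
  (Σ (Subset n) λ S → DoubleDominating G S × ∣ S ∣ ≡ k) ×
  (∀ (S : Subset n) → DoubleDominating G S → k ≤ ∣ S ∣)

module Submission where

-- Root the tree T at a vertex r; every edge then joins a non-root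
-- vertex w to its parent p w.  Fix a dominating set S and a double dominating
-- set D, and pick for each v ∉ S an S-vertex dominating it.  Call a non-root
-- vertex w charged when its parent edge is the edge through which S dominates
-- one of its endpoints (w ∉ S with p w ∈ S, or w ∈ S with p w ∉ S and w the
-- chosen S-dominator of p w).  Every vertex outside S is sent injectively to a
-- charged vertex, and every vertex outside D is sent injectively to a non-root
-- vertex that is not charged (itself, a D-child or a D-grandchild).  Hence
-- (n ∸ ∣S∣) + (n ∸ ∣D∣) ≤ n ∸ 1, i.e. ∣D∣ + ∣S∣ ≥ n + 1.

open import Defs hiding (sym)
open import Algebra.Properties.CommutativeSemigroup using (interchange)
open import Data.Empty using (⊥; ⊥-elim)
open import Data.Fin using (Fin; zero; suc; _≟_)
open import Data.Fin.Properties using (any?; suc-injective)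
open import Data.Fin.Subset using (Subset; _∈_; _∉_; ∣_∣; inside; outside)
open import Data.Fin.Subset.Properties using (_∈?_)
open import Data.List using (List; []; _∷_; length; _∷ʳ_)
open import Data.List.Properties using (length-++)
open import Data.List.Relation.Unary.All as All using (All; []; _∷_)
open import Data.List.Relation.Unary.All.Properties using (∷ʳ⁺)
import Data.List.Relation.Unary.AllPairs.Properties as AllPairs
open import Data.List.Relation.Unary.AllPairs using ([]; _∷_)
open import Data.List.Relation.Unary.Unique.Propositional using (Unique)
open import Data.Nat using (ℕ; zero; suc; pred; _+_; _≤_; _≤′_; z≤n; s≤s; ≤′-refl; ≤′-step; _≤?_)
open import Data.Nat.Properties
  using (+-commutativeSemigroup; +-comm; +-suc; +-monoˡ-≤; +-mono-≤; +-cancelʳ-≤; module ≤-Reasoning;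
         ≤-refl; ≤-trans; ≤-reflexive; ≤-antisym; ≤-pred; ≤⇒≤′; ≮⇒≥; 1+n≰n; <-cmp;
         m≤m+n; m≤n⇒m≤1+n; n≤1+n)
open import Data.Product using (Σ; ∃-syntax; _×_; _,_; proj₁; proj₂)
open import Data.Sum using (_⊎_; inj₁; inj₂)
open import Data.Vec using ([]; _∷_; there)
open import Relation.Binary.Definitions using (tri<; tri≈; tri>)
open import Relation.Binary.PropositionalEquality
open import Relation.Nullary using (¬_; Dec; yes; no)
open import Relation.Nullary.Decidable using (_×-dec_; _⊎-dec_; ¬?; decidable-stable; ¬¬-excluded-middle)
open import Relation.Unary using (Decidable)

indicator : ∀ {A : Set} → Dec A → ℕ
indicator (yes _) = 1
indicator (no _)  = 0

count : ∀ {n} {P : Fin n → Set} → Decidable P → ℕ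
count {zero}  P? = 0
count {suc n} P? = indicator (P? zero) + count (λ i → P? (suc i))

interchange-+ : ∀ a b c d → (a + b) + (c + d) ≡ (a + c) + (b + d)
interchange-+ = interchange +-commutativeSemigroup

count-cong : ∀ {n} {P Q : Fin n → Set} (P? : Decidable P) (Q? : Decidable Q) →
  (∀ i → P i → Q i) → (∀ i → Q i → P i) → count P? ≡ count Q?
count-cong {zero}  P? Q? to from = refl
count-cong {suc n} P? Q? to from =
  cong₂ _+_ (indicator-cong (P? zero) (Q? zero) (to zero) (from zero))
            (count-cong (λ i → P? (suc i)) (λ i → Q? (suc i)) (λ i → to (suc i)) (λ i → from (suc i)))
  where
  indicator-cong : ∀ {A B : Set} (a : Dec A) (b : Dec B) → (A → B) → (B → A) → indicator a ≡ indicator b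
  indicator-cong (yes _) (yes _) _ _ = refl
  indicator-cong (yes a) (no ¬b) f _ = ⊥-elim (¬b (f a))
  indicator-cong (no ¬a) (yes b) _ g = ⊥-elim (¬a (g b))
  indicator-cong (no _)  (no _)  _ _ = refl

count-complement : ∀ {n} {P : Fin n → Set} (P? : Decidable P) → count P? + count (λ i → ¬? (P? i)) ≡ n
count-complement {zero}  P? = refl
count-complement {suc n} P? = begin
  (indicator (P? zero) + count (λ i → P? (suc i))) + (indicator (¬? (P? zero)) + count (λ i → ¬? (P? (suc i))))
    ≡⟨ interchange-+ (indicator (P? zero)) _ _ _ ⟩
  (indicator (P? zero) + indicator (¬? (P? zero))) + (count (λ i → P? (suc i)) + count (λ i → ¬? (P? (suc i))))
    ≡⟨ cong₂ _+_ (one (P? zero)) (count-complement (λ i → P? (suc i))) ⟩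
  suc n ∎
  where
  open ≡-Reasoning
  one : ∀ {A : Set} (a : Dec A) → indicator a + indicator (¬? a) ≡ 1
  one (yes _) = refl
  one (no _)  = refl

count-split : ∀ {n} {P Q : Fin n → Set} (P? : Decidable P) (Q? : Decidable Q) →
  count P? ≡ count (λ i → P? i ×-dec Q? i) + count (λ i → P? i ×-dec ¬? (Q? i))
count-split {zero}  P? Q? = refl
count-split {suc n} P? Q? = begin
  indicator (P? zero) + count (λ i → P? (suc i))
    ≡⟨ cong₂ _+_ (split (P? zero) (Q? zero)) (count-split (λ i → P? (suc i)) (λ i → Q? (suc i))) ⟩
  (indicator (P? zero ×-dec Q? zero) + indicator (P? zero ×-dec ¬? (Q? zero))) +
  (count (λ i → P? (suc i) ×-dec Q? (suc i)) + count (λ i → P? (suc i) ×-dec ¬? (Q? (suc i))))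
    ≡⟨ interchange-+ (indicator (P? zero ×-dec Q? zero)) _ _ _ ⟩
  count (λ i → P? i ×-dec Q? i) + count (λ i → P? i ×-dec ¬? (Q? i)) ∎
  where
  open ≡-Reasoning
  split : ∀ {A B : Set} (a : Dec A) (b : Dec B) → indicator a ≡ indicator (a ×-dec b) + indicator (a ×-dec ¬? b)
  split (yes _) (yes _) = refl
  split (yes _) (no _)  = refl
  split (no _)  (yes _) = refl
  split (no _)  (no _)  = refl

count-remove : ∀ {n} {Q : Fin n → Set} (Q? : Decidable Q) (y : Fin n) → Q y →
  count Q? ≡ suc (count (λ i → Q? i ×-dec ¬? (i ≟ y)))
count-remove {suc n} Q? zero q with Q? zero
... | no ¬q = ⊥-elim (¬q q)
... | yes _ = cong suc (count-cong (λ i → Q? (suc i)) (λ i → Q? (suc i) ×-dec ¬? (suc i ≟ zero))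
                          (λ _ qi → qi , λ ()) (λ _ → proj₁))
count-remove {suc n} Q? (suc y) q = begin
  indicator (Q? zero) + count (λ i → Q? (suc i))
    ≡⟨ cong₂ _+_ head (count-remove (λ i → Q? (suc i)) y q) ⟩
  indicator (Q? zero ×-dec ¬? (zero ≟ suc y)) + suc (count (λ i → Q? (suc i) ×-dec ¬? (i ≟ y)))
    ≡⟨ cong (λ m → indicator (Q? zero ×-dec ¬? (zero ≟ suc y)) + suc m) tail ⟩
  indicator (Q? zero ×-dec ¬? (zero ≟ suc y)) + suc (count (λ i → Q? (suc i) ×-dec ¬? (suc i ≟ suc y)))
    ≡⟨ +-suc _ _ ⟩
  suc (count (λ i → Q? i ×-dec ¬? (i ≟ suc y))) ∎
  where
  open ≡-Reasoning
  head : indicator (Q? zero) ≡ indicator (Q? zero ×-dec ¬? (zero ≟ suc y))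
  head with Q? zero
  ... | yes _ = refl
  ... | no _  = refl
  tail : count (λ i → Q? (suc i) ×-dec ¬? (i ≟ y)) ≡ count (λ i → Q? (suc i) ×-dec ¬? (suc i ≟ suc y))
  tail = count-cong (λ i → Q? (suc i) ×-dec ¬? (i ≟ y)) (λ i → Q? (suc i) ×-dec ¬? (suc i ≟ suc y))
                    (λ _ (qi , i≢y) → qi , λ e → i≢y (suc-injective e))
                    (λ _ (qi , si≢sy) → qi , λ e → si≢sy (cong suc e))

count-injection : ∀ {n m} {P : Fin n → Set} {Q : Fin m → Set}
  (P? : Decidable P) (Q? : Decidable Q) (R : Fin n → Fin m → Set) →
  (∀ x → P x → Σ (Fin m) λ y → Q y × R x y) →
  (∀ {x x′ y} → R x y → R x′ y → x ≡ x′) → count P? ≤ count Q?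
count-injection {zero} P? Q? R image injective = z≤n
count-injection {suc n} {P = P} {Q} P? Q? R image injective with P? zero
... | no _ = count-injection (λ x → P? (suc x)) Q? (λ x → R (suc x))
               (λ x → image (suc x)) (λ r r′ → suc-injective (injective r r′))
... | yes p₀ with image zero p₀
...   | y₀ , q₀ , r₀ =
  subst (suc (count (λ x → P? (suc x))) ≤_) (sym (count-remove Q? y₀ q₀))
    (s≤s (count-injection (λ x → P? (suc x)) (λ y → Q? y ×-dec ¬? (y ≟ y₀)) (λ x → R (suc x))
           image′ (λ r r′ → suc-injective (injective r r′))))
  where
  image′ : ∀ x → P (suc x) → Σ (Fin _) λ y → (Q y × y ≢ y₀) × R (suc x) y
  image′ x px with image (suc x) px
  ... | y , qy , rxy = y , (qy , λ { refl → zero≢suc (injective r₀ rxy) }) , rxy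
    where
    zero≢suc : ∀ {k} {i : Fin k} → zero ≢ suc i
    zero≢suc ()

count-none : ∀ {n} {P : Fin n → Set} (P? : Decidable P) → (∀ i → ¬ P i) → count P? ≡ 0
count-none {zero}  P? none = refl
count-none {suc n} P? none with P? zero
... | yes p₀ = ⊥-elim (none zero p₀)
... | no _   = count-none (λ i → P? (suc i)) (λ i → none (suc i))

∣S∣≡count : ∀ {n} (S : Subset n) → ∣ S ∣ ≡ count (_∈? S)
∣S∣≡count []            = refl
∣S∣≡count (inside ∷ S)  =
  cong suc (trans (∣S∣≡count S) (count-cong (_∈? S) (λ i → suc i ∈? (inside ∷ S)) (λ _ → there) (λ _ → drop)))
  where drop : ∀ {i} → suc i ∈ (inside ∷ S) → i ∈ S
        drop (there i∈S) = i∈S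
∣S∣≡count (outside ∷ S) =
  trans (∣S∣≡count S) (count-cong (_∈? S) (λ i → suc i ∈? (outside ∷ S)) (λ _ → there) (λ _ → drop))
  where drop : ∀ {i} → suc i ∈ (outside ∷ S) → i ∈ S
        drop (there i∈S) = i∈S

count-others : ∀ {n} (r : Fin n) → suc (count (λ v → ¬? (v ≟ r))) ≡ n
count-others {n} r = begin
  suc (count (λ v → ¬? (v ≟ r)))                    ≡⟨ cong (_+ count (λ v → ¬? (v ≟ r))) (sym just-r) ⟩
  count (_≟ r) + count (λ v → ¬? (v ≟ r))         ≡⟨ count-complement (_≟ r) ⟩
  n ∎
  where
  open ≡-Reasoning
  nothing-else : count (λ v → (v ≟ r) ×-dec ¬? (v ≟ r)) ≡ 0
  nothing-else = count-none (λ v → (v ≟ r) ×-dec ¬? (v ≟ r)) (λ _ (v≡r , v≢r) → v≢r v≡r)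
  just-r : count (_≟ r) ≡ 1
  just-r = trans (count-remove (_≟ r) r refl) (cong suc nothing-else)

least-witness : {P : ℕ → Set} → (∀ k → Dec (P k)) → (∀ {j k} → j ≤ k → P j → P k) →
  ∀ k → P k → Σ ℕ λ m → P m × (∀ j → P j → m ≤ j)
least-witness P? up zero    p = zero , p , λ _ _ → z≤n
least-witness P? up (suc k) p with P? k
... | yes pk = least-witness P? up k pk
... | no ¬pk = suc k , p , λ j pj → ≮⇒≥ (λ j<sk → ¬pk (up (≤-pred j<sk) pj))

walk-∷ʳ : ∀ {n} {G : Graph n} {a b c vs} → Walk G a b vs → Adj G b c → Walk G a c (vs ∷ʳ c)
walk-∷ʳ here       bc = step bc here
walk-∷ʳ (step e w) bc = step e (walk-∷ʳ w bc)

length-∷ʳ : ∀ {A : Set} (xs : List A) (y : A) → length xs ≤ length (xs ∷ʳ y)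
length-∷ʳ xs y = ≤-trans (m≤m+n (length xs) 1) (≤-reflexive (sym (length-++ xs)))

IsRooting : ∀ {n} → Graph n → Fin n → (Fin n → Fin n) → Set
IsRooting G r p = ∀ {u v} → Adj G u v → (u ≢ r × p u ≡ v) ⊎ (v ≢ r × p v ≡ u)

-- Every tree with decidable adjacency can be rooted at any vertex r: the parent
-- of v ≠ r is a neighbour one step closer to r.
module Rooting {n} (G : Graph n) (adj? : ∀ u v → Dec (Adj G u v))
               (conn : Connected G) (acyc : Acyclic G) (r : Fin n) where

  -- Near k v: some walk of at most k edges leads from v to r.
  Near : ℕ → Fin n → Set
  Near zero    v = v ≡ r
  Near (suc k) v = Near k v ⊎ ∃[ w ] (Near k w × Adj G v w)

  near? : ∀ k v → Dec (Near k v)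
  near? zero    v = v ≟ r
  near? (suc k) v = near? k v ⊎-dec any? (λ w → near? k w ×-dec adj? v w)

  near-mono : ∀ {j k v} → j ≤ k → Near j v → Near k v
  near-mono j≤k = go (≤⇒≤′ j≤k)
    where
    go : ∀ {j k v} → j ≤′ k → Near j v → Near k v
    go ≤′-refl        x = x
    go (≤′-step j≤′k) x = inj₁ (go j≤′k x)

  walk⇒near : ∀ {v vs} → Walk G v r vs → ∃[ k ] Near k v
  walk⇒near here = 0 , refl
  walk⇒near (step vw w) with walk⇒near w
  ... | k , near = suc k , inj₂ (_ , near , vw)

  depth-info : ∀ v → Σ ℕ λ m → Near m v × (∀ j → Near j v → m ≤ j)
  depth-info v = least-witness (λ k → near? k v) near-mono _ (proj₂ (walk⇒near (proj₂ (conn v r))))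

  depth : Fin n → ℕ
  depth v = proj₁ (depth-info v)

  depth-near : ∀ v → Near (depth v) v
  depth-near v = proj₁ (proj₂ (depth-info v))

  depth-least : ∀ v j → Near j v → depth v ≤ j
  depth-least v = proj₂ (proj₂ (depth-info v))

  depth-edge : ∀ {u v} → Adj G u v → depth v ≤ suc (depth u)
  depth-edge {u} {v} uv = depth-least v (suc (depth u)) (inj₂ (u , depth-near u , Graph.sym G uv))

  depth-root : ∀ {v} → depth v ≡ 0 → v ≡ r
  depth-root {v} d≡0 = subst (λ k → Near k v) d≡0 (depth-near v)

  step-to-root : ∀ v k → Near (suc k) v → (∀ j → Near j v → suc k ≤ j) →
    Σ (Fin n) λ w → Adj G v w × depth w ≡ k
  step-to-root v k (inj₁ near) minimal = ⊥-elim (1+n≰n (minimal k near))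
  step-to-root v k (inj₂ (w , near-w , vw)) minimal =
    w , vw , ≤-antisym (depth-least w k near-w)
                       (≤-pred (minimal (suc (depth w)) (inj₂ (w , depth-near w , vw))))

  parent-step : ∀ v → v ≢ r → Σ (Fin n) λ w → Adj G v w × suc (depth w) ≡ depth v
  parent-step v v≢r with depth v | depth-near v | depth-least v
  ... | zero  | near | _       = ⊥-elim (v≢r near)
  ... | suc k | near | minimal with step-to-root v k near minimal
  ...   | w , vw , dw≡k = w , vw , cong suc dw≡k

  -- The parent of v ≠ r (the root is its own parent, a value never used).
  parent : Fin n → Fin n
  parent v with v ≟ r
  ... | yes _   = r
  ... | no v≢r  = proj₁ (parent-step v v≢r)

  parent-spec : ∀ v → v ≢ r → Adj G v (parent v) × suc (depth (parent v)) ≡ depth v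
  parent-spec v v≢r with v ≟ r
  ... | yes v≡r  = ⊥-elim (v≢r v≡r)
  ... | no v≢r′  = proj₂ (parent-step v v≢r′)

  not-root : ∀ {v k} → depth v ≡ suc k → v ≢ r
  not-root {v} dv≡ v≡r with subst (_≤ 0) dv≡ (depth-least v 0 v≡r)
  ... | ()

  parent-depth : ∀ {v k} → depth v ≡ suc k → depth (parent v) ≡ k
  parent-depth {v} dv≡ = cong pred (trans (proj₂ (parent-spec v (not-root dv≡))) dv≡)

  parent-adj : ∀ {v k} → depth v ≡ suc k → Adj G v (parent v)
  parent-adj {v} dv≡ = proj₁ (parent-spec v (not-root dv≡))

  deeper-differs : ∀ {x z k} → depth x ≡ suc k → depth z ≤ k → z ≢ x
  deeper-differs dx dz refl = 1+n≰n (subst (_≤ _) dx dz)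

  record LowPath (k : ℕ) (x y : Fin n) : Set where
    field
      vertices : List (Fin n)
      walk     : Walk G x y vertices
      distinct : Unique vertices
      long     : 3 ≤ length vertices
      low      : All (λ z → depth z ≤ k) vertices

  no-closing-edge : ∀ {k x y} → LowPath k x y → ¬ Adj G y x
  no-closing-edge {x = x} {y} π yx = acyc (x , y , vertices , walk , distinct , long , yx)
    where open LowPath π

  append : ∀ {k a b y} → depth y ≡ suc k → Adj G b y → LowPath k a b → LowPath (suc k) a y
  append {y = y} dy by π = record
    { vertices = vertices ∷ʳ y
    ; walk     = walk-∷ʳ walk by
    ; distinct = AllPairs.++⁺ distinct ([] ∷ []) (All.map (λ low-z → deeper-differs dy low-z ∷ []) low)
    ; long     = ≤-trans long (length-∷ʳ vertices y)
    ; low      = ∷ʳ⁺ (All.map m≤n⇒m≤1+n low) (≤-reflexive dy)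
    }
    where open LowPath π

  widen : ∀ {k a b x y} → depth x ≡ suc k → depth y ≡ suc k → x ≢ y →
    Adj G x a → Adj G b y → LowPath k a b → LowPath (suc k) x y
  widen {x = x} dx dy x≢y xa by π = record
    { vertices = x ∷ vertices
    ; walk     = step xa walk
    ; distinct = ∷ʳ⁺ (All.map (λ low-z z≡x → deeper-differs dx low-z (sym z≡x)) (LowPath.low π)) x≢y
                 ∷ distinct
    ; long     = ≤-trans long (n≤1+n _)
    ; low      = ≤-reflexive dx ∷ low
    }
    where open LowPath (append dy by π)

  -- Two distinct vertices of the same depth k are joined by a low path: follow
  -- parents upwards until the two ancestors meet.
  level-path : ∀ k {x y} → depth x ≡ k → depth y ≡ k → x ≢ y → LowPath k x y
  level-path zero    dx dy x≢y = ⊥-elim (x≢y (trans (depth-root dx) (sym (depth-root dy))))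
  level-path (suc k) {x} {y} dx dy x≢y with parent x ≟ parent y
  ... | yes px≡py = record
    { vertices = x ∷ parent x ∷ y ∷ []
    ; walk     = step (parent-adj dx) (step (subst (λ z → Adj G z y) (sym px≡py) (Graph.sym G (parent-adj dy))) here)
    ; distinct = (x≢px ∷ x≢y ∷ []) ∷ (px≢y ∷ []) ∷ [] ∷ []
    ; long     = ≤-refl
    ; low      = ≤-reflexive dx ∷ m≤n⇒m≤1+n (≤-reflexive (parent-depth dx)) ∷ ≤-reflexive dy ∷ []
    }
    where
    x≢px : x ≢ parent x
    x≢px x≡px = deeper-differs dx (≤-reflexive (parent-depth dx)) (sym x≡px)
    px≢y : parent x ≢ y
    px≢y = deeper-differs dy (≤-reflexive (parent-depth dx))
  ... | no px≢py =
    widen dx dy x≢y (parent-adj dx) (Graph.sym G (parent-adj dy))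
          (level-path k (parent-depth dx) (parent-depth dy) px≢py)

  -- If v lies one level below its neighbour u, then u is the parent of v;
  -- otherwise v, parent v, …, u, v would be a cycle.
  deeper-end : ∀ {u v} → Adj G u v → depth v ≡ suc (depth u) → v ≢ r × parent v ≡ u
  deeper-end {u} {v} uv dv with parent v ≟ u
  ... | yes pv≡u = not-root dv , pv≡u
  ... | no pv≢u  = ⊥-elim (no-closing-edge (append dv uv (level-path (depth u) (parent-depth dv) refl pv≢u))
                                           (parent-adj dv))

  -- Compare the depths of the endpoints of an edge: the deeper one is a child of
  -- the other, and equal depths would close a cycle.
  parent-rooting : IsRooting G r parent
  parent-rooting {u} {v} uv with <-cmp (depth u) (depth v)
  ... | tri< du<dv _ _ = inj₂ (deeper-end uv (≤-antisym (depth-edge uv) du<dv))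
  ... | tri> _ _ dv<du = inj₁ (deeper-end (Graph.sym G uv) (≤-antisym (depth-edge (Graph.sym G uv)) dv<du))
  ... | tri≈ _ du≡dv _ =
    ⊥-elim (no-closing-edge (level-path (depth u) refl (sym du≡dv) u≢v) (Graph.sym G uv))
    where u≢v : u ≢ v
          u≢v refl = Graph.irrefl G uv

complements-bound : ∀ {n X Y A B} → X + A ≡ n → Y + B ≡ n → suc (A + B) ≤ n → suc n ≤ X + Y
complements-bound {n} {X} {Y} {A} {B} X+A≡n Y+B≡n A+B<n = +-cancelʳ-≤ (A + B) (suc n) (X + Y) (begin
  suc n + (A + B)      ≡⟨ +-comm (suc n) (A + B) ⟩
  (A + B) + suc n      ≡⟨ +-suc (A + B) n ⟩
  suc (A + B) + n      ≤⟨ +-monoˡ-≤ n A+B<n ⟩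
  n + n                ≡⟨ cong₂ _+_ (sym X+A≡n) (sym Y+B≡n) ⟩
  (X + A) + (Y + B)    ≡⟨ interchange-+ X A Y B ⟩
  (X + Y) + (A + B)    ∎)
  where open ≤-Reasoning

module Charging {n} (G : Graph n) (r : Fin n) (p : Fin n → Fin n) (rooting : IsRooting G r p)
                (S : Subset n) (dom : Dominating G S) (D : Subset n) (dd : DoubleDominating G D) where

  Child : Fin n → Fin n → Set
  Child v c = c ≢ r × p c ≡ v

  child? : ∀ v c → Dec (Child v c)
  child? v c = ¬? (c ≟ r) ×-dec (p c ≟ v)

  non-root? : Decidable (_≢ r)
  non-root? w = ¬? (w ≟ r)

  ParentInS : Fin n → Set
  ParentInS v = v ≢ r × p v ∈ S

  parentInS? : Decidable ParentInS
  parentInS? v = ¬? (v ≟ r) ×-dec (p v ∈? S)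

  Dominator : Fin n → Fin n → Set
  Dominator v c = (ParentInS v × c ≡ p v) ⊎ (¬ ParentInS v × Child v c × c ∈ S)

  -- Some S-vertex dominates each v ∉ S, from above or below; for v ∈ S any
  -- value will do.
  choose-dominator : ∀ v → Σ (Fin n) λ c → v ∉ S → Dominator v c
  choose-dominator v with parentInS? v | any? (λ c → child? v c ×-dec (c ∈? S))
  ... | yes up | _             = p v , λ _ → inj₁ (up , refl)
  ... | no ¬up | yes (c , c-S) = c , λ _ → inj₂ (¬up , c-S)
  ... | no ¬up | no none       = v , λ v∉S → ⊥-elim (undominated v∉S)
    where
    undominated : v ∉ S → ⊥
    undominated v∉S with dom v
    ... | inj₁ v∈S = v∉S v∈S
    ... | inj₂ (u , u∈S , vu) with rooting vu
    ...   | inj₁ (v≢r , pv≡u) = ¬up (v≢r , subst (_∈ S) (sym pv≡u) u∈S)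
    ...   | inj₂ (u≢r , pu≡v) = none (u , (u≢r , pu≡v) , u∈S)

  dominator : Fin n → Fin n
  dominator v = proj₁ (choose-dominator v)

  dominator-spec : ∀ v → v ∉ S → Dominator v (dominator v)
  dominator-spec v = proj₂ (choose-dominator v)

  -- The parent edge of w is charged to S: S dominates one endpoint through it.
  Charged : Fin n → Set
  Charged w = (w ∉ S × p w ∈ S) ⊎ (w ∈ S × p w ∉ S × dominator (p w) ≡ w)

  charged? : Decidable Charged
  charged? w = (¬? (w ∈? S) ×-dec (p w ∈? S)) ⊎-dec ((w ∈? S) ×-dec ¬? (p w ∈? S) ×-dec (dominator (p w) ≟ w))

  SCharge : Fin n → Fin n → Set
  SCharge v w = (w ≡ v × w ∉ S) ⊎ (p w ≡ v × w ∈ S)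

  S-charge-image : ∀ v → v ∉ S → Σ (Fin n) λ w → (w ≢ r × Charged w) × SCharge v w
  S-charge-image v v∉S with dominator-spec v v∉S
  ... | inj₁ ((v≢r , pv∈S) , _) = v , (v≢r , inj₁ (v∉S , pv∈S)) , inj₁ (refl , v∉S)
  ... | inj₂ (_ , (c≢r , pc≡v) , c∈S) =
    dominator v , (c≢r , inj₂ (c∈S , subst (_∉ S) (sym pc≡v) v∉S , cong dominator pc≡v)) , inj₂ (pc≡v , c∈S)

  -- w determines v: it is w itself or its parent, according to whether w ∈ S.
  S-charge-injective : ∀ {v v′ w} → SCharge v w → SCharge v′ w → v ≡ v′
  S-charge-injective (inj₁ (refl , _))   (inj₁ (refl , _))   = refl
  S-charge-injective (inj₁ (_ , w∉S))    (inj₂ (_ , w∈S))    = ⊥-elim (w∉S w∈S)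
  S-charge-injective (inj₂ (_ , w∈S))    (inj₁ (_ , w∉S))    = ⊥-elim (w∉S w∈S)
  S-charge-injective (inj₂ (refl , _))   (inj₂ (refl , _))   = refl

  outside-S≤charged : count (λ v → ¬? (v ∈? S)) ≤ count (λ w → non-root? w ×-dec charged? w)
  outside-S≤charged = count-injection _ _ SCharge S-charge-image S-charge-injective

  other-D : ∀ v z → Σ (Fin n) λ x → x ≢ z × x ∈ D × InClosedNbhd G v x
  other-D v z with dd v
  ... | a , b , a≢b , (a∈D , a-near) , (b∈D , b-near) with a ≟ z
  ...   | yes refl = b , (λ b≡a → a≢b (sym b≡a)) , b∈D , b-near
  ...   | no a≢z   = a , a≢z , a∈D , a-near

  neighbour-D : ∀ v z → v ∉ D ⊎ v ≡ z → Σ (Fin n) λ x → x ≢ z × x ∈ D × Adj G v x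
  neighbour-D v z v-ok with other-D v z
  ... | x , x≢z , x∈D , inj₂ vx = x , x≢z , x∈D , vx
  ... | x , x≢z , x∈D , inj₁ refl with v-ok
  ...   | inj₁ x∉D  = ⊥-elim (x∉D x∈D)
  ...   | inj₂ x≡z  = ⊥-elim (x≢z x≡z)

  D-child : ∀ u → u ∉ D → Σ (Fin n) λ c → (Child u c × c ∈ D) × Σ (Fin n) λ b → b ≢ c × b ∈ D × Adj G u b
  D-child u u∉D with neighbour-D u u (inj₁ u∉D)
  ... | a , _ , a∈D , ua with neighbour-D u a (inj₁ u∉D)
  ...   | b , b≢a , b∈D , ub with rooting ua | rooting ub
  ...     | inj₂ a-child  | _             = a , (a-child , a∈D) , b , b≢a , b∈D , ub
  ...     | inj₁ _        | inj₂ b-child  = b , (b-child , b∈D) , a , (λ a≡b → b≢a (sym a≡b)) , a∈D , ua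
  ...     | inj₁ (_ , pu≡a) | inj₁ (_ , pu≡b) = ⊥-elim (b≢a (trans (sym pu≡b) pu≡a))

  D-grandchild : ∀ {c u} → p c ≡ u → u ∉ D → Σ (Fin n) λ x → Child c x × x ∈ D
  D-grandchild {c} pc≡u u∉D with neighbour-D c c (inj₂ refl)
  ... | x , _ , x∈D , cx with rooting cx
  ...   | inj₁ (_ , pc≡x) = ⊥-elim (u∉D (subst (_∈ D) (trans (sym pc≡x) pc≡u) x∈D))
  ...   | inj₂ x-child    = x , x-child , x∈D

  -- A vertex u ∉ D is charged to itself, to a D-child, or to a D-grandchild (whose
  -- parent is in D); which case applies is read off from x, giving injectivity.
  DCharge : Fin n → Fin n → Set
  DCharge u x = (x ≡ u × x ∉ D) ⊎ (p x ≡ u × x ∈ D × p x ∉ D) ⊎ (p (p x) ≡ u × x ∈ D × p x ∈ D)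

  D-charge-injective : ∀ {u u′ x} → DCharge u x → DCharge u′ x → u ≡ u′
  D-charge-injective (inj₁ (refl , _)) (inj₁ (refl , _)) = refl
  D-charge-injective (inj₂ (inj₁ (refl , _))) (inj₂ (inj₁ (refl , _))) = refl
  D-charge-injective (inj₂ (inj₂ (refl , _))) (inj₂ (inj₂ (refl , _))) = refl
  D-charge-injective (inj₁ (_ , x∉D)) (inj₂ (inj₁ (_ , x∈D , _))) = ⊥-elim (x∉D x∈D)
  D-charge-injective (inj₁ (_ , x∉D)) (inj₂ (inj₂ (_ , x∈D , _))) = ⊥-elim (x∉D x∈D)
  D-charge-injective (inj₂ (inj₁ (_ , x∈D , _))) (inj₁ (_ , x∉D)) = ⊥-elim (x∉D x∈D)
  D-charge-injective (inj₂ (inj₂ (_ , x∈D , _))) (inj₁ (_ , x∉D)) = ⊥-elim (x∉D x∈D)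
  D-charge-injective (inj₂ (inj₁ (_ , _ , px∉D))) (inj₂ (inj₂ (_ , _ , px∈D))) = ⊥-elim (px∉D px∈D)
  D-charge-injective (inj₂ (inj₂ (_ , _ , px∈D))) (inj₂ (inj₁ (_ , _ , px∉D))) = ⊥-elim (px∉D px∈D)

  Uncharged : Fin n → Set
  Uncharged x = x ≢ r × ¬ Charged x

  -- Image of u ∉ D when u ∈ S: the D-child c if c ∈ S, otherwise a D-grandchild.
  D-charge-in-S : ∀ {u c} → u ∉ D → u ∈ S → Child u c → c ∈ D → Σ (Fin n) λ x → Uncharged x × DCharge u x
  D-charge-in-S {u} {c} u∉D u∈S (c≢r , pc≡u) c∈D with c ∈? S
  ... | yes c∈S = c , (c≢r , uncharged) , inj₂ (inj₁ (pc≡u , c∈D , subst (_∉ D) (sym pc≡u) u∉D))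
    where
    uncharged : ¬ Charged c
    uncharged (inj₁ (c∉S , _))     = c∉S c∈S
    uncharged (inj₂ (_ , pc∉S , _)) = pc∉S (subst (_∈ S) (sym pc≡u) u∈S)
  ... | no c∉S with D-grandchild pc≡u u∉D
  ...   | x , (x≢r , px≡c) , x∈D =
    x , (x≢r , uncharged) , inj₂ (inj₂ (trans (cong p px≡c) pc≡u , x∈D , subst (_∈ D) (sym px≡c) c∈D))
    where
    uncharged : ¬ Charged x
    uncharged (inj₁ (_ , px∈S)) = c∉S (subst (_∈ S) px≡c px∈S)
    uncharged (inj₂ (_ , _ , dom-px≡x)) with dominator-spec c c∉S
    ... | inj₂ (¬up , _) = ¬up (c≢r , subst (_∈ S) (sym pc≡u) u∈S)
    ... | inj₁ (_ , dom-c≡pc) =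
      u∉D (subst (_∈ D) (trans (sym dom-px≡x) (trans (cong dominator px≡c) (trans dom-c≡pc pc≡u))) x∈D)

  -- Image of u ∉ D when u ∉ S: the D-child c unless c is charged (then c is the
  -- S-dominator of u), in which case u itself or the other D-neighbour b.
  D-charge-out-S : ∀ {u c b} → u ∉ D → u ∉ S → Child u c → c ∈ D → b ≢ c → b ∈ D → Adj G u b →
    Σ (Fin n) λ x → Uncharged x × DCharge u x
  D-charge-out-S {u} {c} {b} u∉D u∉S (c≢r , pc≡u) c∈D b≢c b∈D ub with charged? c
  ... | no uncharged = c , (c≢r , uncharged) , inj₂ (inj₁ (pc≡u , c∈D , subst (_∉ D) (sym pc≡u) u∉D))
  ... | yes (inj₁ (_ , pc∈S)) = ⊥-elim (u∉S (subst (_∈ S) pc≡u pc∈S))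
  ... | yes (inj₂ (_ , _ , dom-pc≡c)) with rooting ub
  ...   | inj₁ (u≢r , pu≡b) = u , (u≢r , uncharged) , inj₁ (refl , u∉D)
    where
    uncharged : ¬ Charged u
    uncharged (inj₂ (u∈S , _)) = u∉S u∈S
    uncharged (inj₁ (_ , pu∈S)) with dominator-spec u u∉S
    ... | inj₂ (¬up , _)      = ¬up (u≢r , pu∈S)
    ... | inj₁ (_ , dom-u≡pu) = b≢c (trans (sym pu≡b) (trans (sym dom-u≡pu) (trans (cong dominator (sym pc≡u)) dom-pc≡c)))
  ...   | inj₂ (b≢r , pb≡u) = b , (b≢r , uncharged) , inj₂ (inj₁ (pb≡u , b∈D , subst (_∉ D) (sym pb≡u) u∉D))
    where
    uncharged : ¬ Charged b
    uncharged (inj₁ (_ , pb∈S))          = u∉S (subst (_∈ S) pb≡u pb∈S)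
    uncharged (inj₂ (_ , _ , dom-pb≡b)) =
      b≢c (trans (sym dom-pb≡b) (trans (cong dominator (trans pb≡u (sym pc≡u))) dom-pc≡c))

  D-charge-image : ∀ u → u ∉ D → Σ (Fin n) λ x → Uncharged x × DCharge u x
  D-charge-image u u∉D with D-child u u∉D | u ∈? S
  ... | c , (c-child , c∈D) , _ | yes u∈S = D-charge-in-S u∉D u∈S c-child c∈D
  ... | c , (c-child , c∈D) , b , b≢c , b∈D , ub | no u∉S = D-charge-out-S u∉D u∉S c-child c∈D b≢c b∈D ub

  outside-D≤uncharged : count (λ v → ¬? (v ∈? D)) ≤ count (λ w → non-root? w ×-dec ¬? (charged? w))
  outside-D≤uncharged = count-injection _ _ DCharge D-charge-image D-charge-injective

  rooted-bound : suc n ≤ ∣ D ∣ + ∣ S ∣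
  rooted-bound = complements-bound {A = co-size D} {B = co-size S} (size+co-size D) (size+co-size S) (begin
    suc (co-size D + co-size S)        ≤⟨ s≤s (+-mono-≤ outside-D≤uncharged outside-S≤charged) ⟩
    suc (uncharged + charged)          ≡⟨ cong suc (+-comm uncharged charged) ⟩
    suc (charged + uncharged)          ≡⟨ cong suc (sym (count-split non-root? charged?)) ⟩
    suc (count non-root?)              ≡⟨ count-others r ⟩
    n                                  ∎)
    where
    open ≤-Reasoning
    co-size : Subset n → ℕ
    co-size X = count (λ v → ¬? (v ∈? X))
    charged uncharged : ℕ
    charged   = count (λ w → non-root? w ×-dec charged? w)
    uncharged = count (λ w → non-root? w ×-dec ¬? (charged? w))
    size+co-size : ∀ X → ∣ X ∣ + co-size X ≡ n
    size+co-size X = trans (cong (_+ co-size X) (∣S∣≡count X)) (count-complement (_∈? X))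

¬¬-finite-∀ : ∀ n {P : Fin n → Set} → (∀ i → ¬ ¬ P i) → ¬ ¬ (∀ i → P i)
¬¬-finite-∀ zero    _      k = k (λ ())
¬¬-finite-∀ (suc n) ¬¬P k =
  ¬¬P zero (λ p₀ → ¬¬-finite-∀ n (λ i → ¬¬P (suc i)) (λ ps → k (λ { zero → p₀ ; (suc i) → ps i })))

¬¬-adjacency-decidable : ∀ {n} (G : Graph n) → ¬ ¬ (∀ u v → Dec (Adj G u v))
¬¬-adjacency-decidable {n} G = ¬¬-finite-∀ n (λ u → ¬¬-finite-∀ n (λ v → ¬¬-excluded-middle))

-- Main theorem: γ×2(T) + γ(T) ≥ n + 1.  The conclusion is decidable, so we may
-- assume decidable adjacency, root T at vertex zero and apply the charging bound
-- to a minimum dominating set and a minimum double dominating set.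
theorem3p10 : ∀ (n : ℕ) (T : Graph n) → IsTree T → 2 ≤ n →
    ∀ (γ γ×2 : ℕ) → IsDominationNumber T γ → IsDoubleDominationNumber T γ×2 →
    suc n ≤ γ×2 + γ
theorem3p10 zero    T _ () _ _ _ _
theorem3p10 (suc m) T (connected , acyclic) _ γ γ×2 ((S , dom-S , ∣S∣≡γ) , _) ((D , dd-D , ∣D∣≡γ×2) , _) =
  decidable-stable (suc (suc m) ≤? γ×2 + γ) λ bound-fails →
    ¬¬-adjacency-decidable T λ adj? →
      let open Rooting T adj? connected acyclic zero using (parent; parent-rooting)
      in bound-fails (subst₂ (λ d s → suc (suc m) ≤ d + s) ∣D∣≡γ×2 ∣S∣≡γ
                       (Charging.rooted-bound T zero parent parent-rooting S dom-S D dd-D))
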